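{- Let $\mathcal{C}$ be a collection of $\mathbf{S}$-structures that is guarded-diagrammatically $(n,m,\ell)$-compatible, for integers $n,m\geq0$ with $n+m>0$ and $\ell>0$. Then $\mathcal{C}$ is diagrammatically $(n,m,\ell)$-compatible.
   Context: A schema $\mathbf{S}$ is a finite set of relation symbols with positive arities. An $\mathbf{S}$-structure $I$ has a domain $\mathrm{dom}(I)$ contained in a fixed countably infinite set of constants and relations $R^I\subseteq\mathrm{dom}(I)^{\mathrm{ar}(R)}$; $\mathrm{facts}(I)$ is its set of facts, $\mathrm{adom}(I)$ the set of elements occurring in facts. $J\subseteq I$ means $\mathrm{facts}(J)\subseteq\mathrm{facts}(I)$; $J\preceq I$ means $\mathrm{dom}(J)\subseteq\mathrm{dom}(I)$ and $R^J=R^I\cap\mathrm{dom}(J)^{\mathrm{ar}(R)}$ for all $R$. Diagrams: sentences may mention constants, interpreted as themselves. For an $\mathbf{S}$-structure $I$, a finite $K\subseteq I$ with $\mathrm{dom}(K)=\mathrm{adom}(K)$, and $m\geq0$: with distinct variables $y_1,\dots,y_m$, $C_{K,m}$ is the set of conjunctions of atoms $R(\bar u)$, $R\in\mathbf{S}$, $\bar u\in(\mathrm{dom}(K)\cup\{y_1,\dots,y_m\})^{\mathrm{ar}(R)}$; $N^I_{K,m}=\{\gamma(\bar y)\in C_{K,m}:I\not\models\exists\bar y\,\gamma(\bar y)\}$. For $G\subseteq N^I_{K,m}$ with $|G|\leq\ell$, $\Delta^I_{K,G}=\bigwedge_{\alpha\in\mathrm{facts}(K)}\alpha\wedge\bigwedge_{c\neq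 d\in\mathrm{dom}(K)}\neg(c=d)\wedge\bigwedge_{\gamma\in G}\neg\exists\bar y\,\gamma(\bar y)$ is an $(m,\ell)$-diagram of $K$ relative to $I$. $\mathcal{C}$ is diagrammatically $(n,m,\ell)$-compatible with $I$ if for every $K\preceq I$ with $\mathrm{dom}(K)=\mathrm{adom}(K)$, $|\mathrm{dom}(K)|\leq n$, and every $(m,\ell)$-diagram $\Delta$ of $K$ relative to $I$, some $J\in\mathcal{C}$ satisfies $\Delta$. A structure $K$ is guarded if $\mathrm{facts}(K)=\emptyset$ or some fact $R(c_1,\dots,c_r)\in\mathrm{facts}(K)$ satisfies $\mathrm{adom}(K)=\{c_1,\dots,c_r\}$; $\mathcal{C}$ is guarded-diagrammatically $(n,m,\ell)$-compatible with $I$ if the same condition holds for every guarded $K\preceq I$ with $\mathrm{dom}(K)=\mathrm{adom}(K)$ and $|\mathrm{dom}(K)|\leq n$. $\mathcal{C}$ is (guarded-)diagrammatically $(n,m,\ell)$-compatible if every $\mathbf{S}$-structure $I$ with which $\mathcal{C}$ is (guarded-)diagrammatically $(n,m,\ell)$-compatible belongs to $\mathcal{C}$. -}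

module Defs where

open import Data.Nat using (ℕ; _≤_; _<_)
open import Data.Fin using (Fin)
open import Data.Vec using (Vec; map)
open import Data.Vec.Relation.Unary.All using () renaming (All to AllV)
open import Data.Vec.Membership.Propositional using () renaming (_∈_ to _∈V_)
open import Data.List using (List; length)
open import Data.List.Relation.Unary.All using (All)
open import Data.List.Relation.Unary.Unique.Propositional using (Unique)
open import Data.List.Membership.Propositional using (_∈_)
open import Data.Sum using (_⊎_; inj₁; inj₂)
open import Data.Product using (Σ; ∃; _×_; _,_)
open import Relation.Binary.PropositionalEquality using (_≡_; _≢_)
open import Relation.Nullary using (¬_)
open import Function.Bundles using (_⇔_)

Const : Set
Const = ℕ

record Schema : Set where
  field
    size   : ℕ
    ar     : Fin size → ℕ
    ar-pos : ∀ R → 0 < ar R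

open Schema public

Sym : Schema → Set
Sym S = Fin (size S)

record Structure (S : Schema) : Set₁ where
  field
    dom     : Const → Set
    rel     : (R : Sym S) → Vec Const (ar S R) → Set
    rel-dom : ∀ R us → rel R us → AllV dom us

open Structure public

module _ {S : Schema} where

  adom : Structure S → Const → Set
  adom I c = Σ (Sym S) λ R → Σ (Vec Const (ar S R)) λ us → rel I R us × c ∈V us

  _⪯_ : Structure S → Structure S → Set
  J ⪯ I = (∀ c → dom J c → dom I c)
        × (∀ R us → rel J R us ⇔ (rel I R us × AllV (dom J) us))

  DomIsAdom : Structure S → Set
  DomIsAdom K = ∀ c → dom K c ⇔ adom K c

  FinDomAtMost : Structure S → ℕ → Set
  FinDomAtMost K n = Σ (List Const) λ xs →
    Unique xs × length xs ≤ n × (∀ c → dom K c ⇔ c ∈ xs)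

  Guarded : Structure S → Set
  Guarded K = (∀ R us → ¬ rel K R us)
            ⊎ (Σ (Sym S) λ R → Σ (Vec Const (ar S R)) λ us →
                 rel K R us × (∀ c → adom K c ⇔ c ∈V us))

-- Terms over dom(K) ∪ {y_1,…,y_m}: constants or variables y_i (i : Fin m)
Term : ℕ → Set
Term m = Const ⊎ Fin m

Atom : Schema → ℕ → Set
Atom S m = Σ (Sym S) λ R → Vec (Term m) (ar S R)

Conj : Schema → ℕ → Set
Conj S m = List (Atom S m)

evalT : ∀ {m} → (Fin m → Const) → Term m → Const
evalT ys (inj₁ c) = c
evalT ys (inj₂ i) = ys i

module _ {S : Schema} {m : ℕ} where

  TermIn : Structure S → Term m → Set
  TermIn K (inj₁ c) = dom K c
  TermIn K (inj₂ _) = Data.Unit.⊤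
    where import Data.Unit

  InC : Structure S → Conj S m → Set
  InC K γ = All (λ { (R , ts) → AllV (TermIn K) ts }) γ

  SatConj : Structure S → Conj S m → (Fin m → Const) → Set
  SatConj J γ ys = All (λ { (R , ts) → rel J R (map (evalT ys) ts) }) γ

  ExSat : Structure S → Conj S m → Set
  ExSat J γ = Σ (Fin m → Const) λ ys → (∀ i → dom J (ys i)) × SatConj J γ ys

  InN : Structure S → Structure S → Conj S m → Set
  InN I K γ = InC K γ × ¬ ExSat I γ

-- G ⊆ N^I_{K,m} with |G| ≤ ℓ (G given as a list of its elements)
IsDiagramSet : ∀ {S} → Structure S → Structure S → (m ℓ : ℕ) → List (Conj S m) → Set
IsDiagramSet I K m ℓ G = length G ≤ ℓ × All (InN I K) G

SatDiagram : ∀ {S} {m} → Structure S → Structure S → List (Conj S m) → Set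
SatDiagram J K G =
    (∀ R us → rel K R us → rel J R us)
  × (∀ c d → dom K c → dom K d → c ≢ d → ¬ (c ≡ d))
  × All (λ γ → ¬ ExSat J γ) G

Collection : Schema → Set₁
Collection S = Structure S → Set

DiagCompatWith : ∀ {S} → Collection S → Structure S → (n m ℓ : ℕ) → Set₁
DiagCompatWith {S} C I n m ℓ =
  ∀ (K : Structure S) → K ⪯ I → DomIsAdom K → FinDomAtMost K n →
  ∀ (G : List (Conj S m)) → IsDiagramSet I K m ℓ G →
  Σ (Structure S) λ J → C J × SatDiagram J K G

GDiagCompatWith : ∀ {S} → Collection S → Structure S → (n m ℓ : ℕ) → Set₁
GDiagCompatWith {S} C I n m ℓ =
  ∀ (K : Structure S) → Guarded K → K ⪯ I → DomIsAdom K → FinDomAtMost K n →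
  ∀ (G : List (Conj S m)) → IsDiagramSet I K m ℓ G →
  Σ (Structure S) λ J → C J × SatDiagram J K G

DiagCompat : ∀ {S} → Collection S → (n m ℓ : ℕ) → Set₁
DiagCompat {S} C n m ℓ = ∀ (I : Structure S) → DiagCompatWith C I n m ℓ → C I

GDiagCompat : ∀ {S} → Collection S → (n m ℓ : ℕ) → Set₁
GDiagCompat {S} C n m ℓ = ∀ (I : Structure S) → GDiagCompatWith C I n m ℓ → C I

module Submission where

open import Defs
open import Data.Nat using (ℕ; _+_; _<_)

diagCompatWith⇒gDiagCompatWith : ∀ {S} {C : Collection S} {I : Structure S} {n m ℓ : ℕ} →
                                 DiagCompatWith C I n m ℓ → GDiagCompatWith C I n m ℓ
diagCompatWith⇒gDiagCompatWith compat K _ = compat K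

lemma8 : (S : Schema) (C : Collection S) (n m ℓ : ℕ) →
         0 < n + m → 0 < ℓ →
         GDiagCompat C n m ℓ → DiagCompat C n m ℓ
lemma8 S C n m ℓ _ _ closed I compat = closed I (diagCompatWith⇒gDiagCompatWith {C = C} {I} {n} {m} {ℓ} compat)
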